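{- Let $u(z)$ be the unique formal power series in $z$ with $u(0)=0$ satisfying $u\,(u-2)^2=z$, and let $t=u-1$ (so that $z=(1-t)^2(1+t)$). Then for every integer $n\ge 0$, as formal power series in $z$, $$-\frac{(1-t)^n}{1+3t}=-\frac{(2-u)^n}{3u-2}=\sum_{\ell\ge 0}2^{\,n-3\ell-1}\binom{3\ell-n}{\ell}z^\ell .$$
   Context: Here $\binom{a}{\ell}$ for an arbitrary integer $a$ (possibly negative) and integer $\ell\ge0$ denotes the generalized binomial coefficient $a(a-1)\cdots(a-\ell+1)/\ell!$. -}

module Defs where

open import Data.Nat as ℕ using (ℕ; zero; suc; _!)
open import Data.Nat.Properties using (_!≢0)
open import Data.Integer as ℤ using (ℤ; +_; -[1+_])
open import Data.Rational using (ℚ; _+_; _*_; -_; 0ℚ; 1ℚ; _/_; ½)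
import Data.Rational as Q
open import Data.List using (List; []; _∷_; upTo; map; foldr)
open import Relation.Binary.PropositionalEquality using (_≡_)

-- Formal power series in z with rational coefficients: f k = [z^k] f.
PS : Set
PS = ℕ → ℚ

_≋_ : PS → PS → Set
f ≋ g = ∀ k → f k ≡ g k
infix 4 _≋_

const : ℚ → PS
const c zero    = c
const c (suc _) = 0ℚ

zS : PS
zS (suc zero) = 1ℚ
zS _          = 0ℚ

_⊕_ : PS → PS → PS
(f ⊕ g) k = f k + g k
infixl 6 _⊕_

⊖_ : PS → PS
(⊖ f) k = - f k

_⊝_ : PS → PS → PS
f ⊝ g = f ⊕ (⊖ g)
infixl 6 _⊝_

sumℚ : List ℚ → ℚ
sumℚ = foldr _+_ 0ℚ

_⊛_ : PS → PS → PS
(f ⊛ g) k = sumℚ (map (λ i → f i * g (k ℕ.∸ i)) (upTo (suc k)))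
infixl 7 _⊛_

_·_ : ℚ → PS → PS
(c · f) k = c * f k
infixl 7 _·_

_^S_ : PS → ℕ → PS
f ^S zero  = const 1ℚ
f ^S suc n = f ⊛ (f ^S n)

q : ℤ → ℚ
q a = a / 1

pow2ℕ : ℕ → ℚ
pow2ℕ zero    = 1ℚ
pow2ℕ (suc k) = q (+ 2) * pow2ℕ k

pow½ : ℕ → ℚ
pow½ zero    = 1ℚ
pow½ (suc k) = ½ * pow½ k

pow2ℤ : ℤ → ℚ
pow2ℤ (+ k)      = pow2ℕ k
pow2ℤ -[1+ k ]   = pow½ (suc k)

falling : ℤ → ℕ → ℤ
falling a zero    = + 1
falling a (suc ℓ) = falling a ℓ ℤ.* (a ℤ.- + ℓ)

binomℤ : ℤ → ℕ → ℚ
binomℤ a ℓ = _/_ (falling a ℓ) (ℓ !) {{ℓ !≢0}}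

rhs : ℕ → PS
rhs n ℓ = pow2ℤ (+ n ℤ.- + (3 ℕ.* ℓ) ℤ.- + 1) * binomℤ (+ (3 ℕ.* ℓ) ℤ.- + n) ℓ

-- With w = 2 − u we have w(0) = 2 and w³ − 2w² + z = 0, and both identities say
-- (3w − 4)·rhs n = wⁿ.  Applying the Euler operator θ = z d/dz to the cubic gives
-- (3w² − 4w)·θw = −z, hence (3w − 4)·θ(wⁿ⁺²) = −(n+2)·z·wⁿ, so it suffices to show
-- θ(wⁿ⁺²) = −(n+2)·z·rhs n.  This follows from [z^ℓ] wᴺ = 3·rhs(N+1)_ℓ − 4·rhs(N)_ℓ
-- for N ≥ 2: both sides satisfy two linear recurrences (the cubic multiplied by wᴺ,
-- and its θ-derivative) and agree at ℓ = 0 and at N = 0, which determines them by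
-- induction on ℓ.  For the binomial side the recurrences reduce to Pascal's rule and
-- the absorption identity for generalized binomial coefficients.

{-# OPTIONS --safe #-}
module Submission where

open import Defs
open import Data.Nat using (ℕ)
open import Data.Integer using (+_)
open import Data.Product using (_×_)
open import Relation.Binary.PropositionalEquality using (_≡_)

open import Algebra.Bundles using (CommutativeRing)
open import Algebra.Structures using (IsCommutativeRing)
import Algebra.Solver.Ring
import Algebra.Solver.Ring.AlmostCommutativeRing as ACR
open import Data.Integer as ℤ using (ℤ; -[1+_])
import Data.Integer.Properties as ℤP
open import Data.Integer.Tactic.RingSolver using () renaming (solve-∀ to solveℤ)
open import Data.List using (map; applyUpTo)
open import Data.Maybe using (just; nothing)
open import Data.Nat as ℕ using (zero; suc; _!; _∸_; _<_; _≤_; s≤s; z≤n)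
import Data.Nat.Properties as ℕP
open import Data.Product using (_,_)
open import Data.Rational as ℚ using (ℚ; 0ℚ; 1ℚ; _+_; _*_; -_)
import Data.Rational.Properties as ℚP
import Data.Rational.Unnormalised as ℚᵘ
import Data.Rational.Unnormalised.Properties as ℚᵘP
open import Function using (_∘_)
open import Level using (0ℓ)
open import Relation.Binary.Definitions using (WeaklyDecidable)
open import Relation.Binary.PropositionalEquality using (refl; sym; trans; cong; cong₂; subst₂; module ≡-Reasoning)
import Relation.Binary.Reasoning.Setoid
open import Relation.Nullary.Decidable using (yes; no; dec⇒maybe)
open import Tactic.RingSolver using () renaming (solve-∀ to solveℚ)
import Tactic.RingSolver.Core.AlmostCommutativeRing as Reflective

ℚ-ring : Reflective.AlmostCommutativeRing 0ℓ 0ℓ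
ℚ-ring = Reflective.fromCommutativeRing ℚP.+-*-commutativeRing (λ x → dec⇒maybe (0ℚ ℚP.≟ x))

toℚᵘ-/ : ∀ a n .{{_ : ℕ.NonZero n}} → ℚ.toℚᵘ (a ℚ./ n) ℚᵘ.≃ (a ℚᵘ./ n)
toℚᵘ-/ a (suc m) = ℚP.toℚᵘ-fromℚᵘ (ℚᵘ.mkℚᵘ a m)

q-homo₂ : ∀ (_∙_ : ℚ → ℚ → ℚ) (_∙ᵘ_ : ℚᵘ.ℚᵘ → ℚᵘ.ℚᵘ → ℚᵘ.ℚᵘ) (_∙ℤ_ : ℤ → ℤ → ℤ) →
          (∀ x y → ℚ.toℚᵘ (x ∙ y) ℚᵘ.≃ (ℚ.toℚᵘ x ∙ᵘ ℚ.toℚᵘ y)) →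
          (∀ {x x′ y y′} → x ℚᵘ.≃ x′ → y ℚᵘ.≃ y′ → (x ∙ᵘ y) ℚᵘ.≃ (x′ ∙ᵘ y′)) →
          (∀ a b → ((a ∙ℤ b) ℚᵘ./ 1) ℚᵘ.≃ ((a ℚᵘ./ 1) ∙ᵘ (b ℚᵘ./ 1))) →
          ∀ a b → q (a ∙ℤ b) ≡ q a ∙ q b
q-homo₂ _∙_ _∙ᵘ_ _∙ℤ_ toℚᵘ-homo ∙ᵘ-cong homo-/1 a b = ℚP.toℚᵘ-injective (begin
  ℚ.toℚᵘ (q (a ∙ℤ b))                ≈⟨ toℚᵘ-/ (a ∙ℤ b) 1 ⟩
  (a ∙ℤ b) ℚᵘ./ 1                    ≈⟨ homo-/1 a b ⟩
  (a ℚᵘ./ 1) ∙ᵘ (b ℚᵘ./ 1)           ≈⟨ ∙ᵘ-cong (toℚᵘ-/ a 1) (toℚᵘ-/ b 1) ⟨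
  ℚ.toℚᵘ (q a) ∙ᵘ ℚ.toℚᵘ (q b)       ≈⟨ toℚᵘ-homo (q a) (q b) ⟨
  ℚ.toℚᵘ (q a ∙ q b)                 ∎)
  where open ℚᵘP.≃-Reasoning

q-+ : ∀ a b → q (a ℤ.+ b) ≡ q a + q b
q-+ = q-homo₂ _+_ ℚᵘ._+_ ℤ._+_ ℚP.toℚᵘ-homo-+ ℚᵘP.+-cong (λ a b → ℚᵘ.*≡* (cross-multiplied a b))
  where
  cross-multiplied : ∀ a b → (a ℤ.+ b) ℤ.* + 1 ≡ (a ℤ.* + 1 ℤ.+ b ℤ.* + 1) ℤ.* + 1
  cross-multiplied = solveℤ

q-* : ∀ a b → q (a ℤ.* b) ≡ q a * q b
q-* = q-homo₂ _*_ ℚᵘ._*_ ℤ._*_ ℚP.toℚᵘ-homo-* ℚᵘP.*-cong (λ a b → ℚᵘ.*≡* refl)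

q-neg : ∀ a → q (ℤ.- a) ≡ - q a
q-neg a = ℚP.toℚᵘ-injective (begin
  ℚ.toℚᵘ (q (ℤ.- a))        ≈⟨ toℚᵘ-/ (ℤ.- a) 1 ⟩
  ℚᵘ.- (a ℚᵘ./ 1)           ≈⟨ ℚᵘP.-‿cong (toℚᵘ-/ a 1) ⟨
  ℚᵘ.- ℚ.toℚᵘ (q a)         ≈⟨ ℚP.toℚᵘ-homo‿- (q a) ⟨
  ℚ.toℚᵘ (- q a)            ∎)
  where open ℚᵘP.≃-Reasoning

q-suc : ∀ n → q (+ suc n) ≡ 1ℚ + q (+ n)
q-suc n = q-+ (+ 1) (+ n)

q*[a/n]≡q[a] : ∀ a n .{{_ : ℕ.NonZero n}} → q (+ n) * (a ℚ./ n) ≡ q a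
q*[a/n]≡q[a] a n@(suc m) = ℚP.toℚᵘ-injective (begin
  ℚ.toℚᵘ (q (+ n) * (a ℚ./ n))           ≈⟨ ℚP.toℚᵘ-homo-* (q (+ n)) (a ℚ./ n) ⟩
  ℚ.toℚᵘ (q (+ n)) ℚᵘ.* ℚ.toℚᵘ (a ℚ./ n) ≈⟨ ℚᵘP.*-cong (toℚᵘ-/ (+ n) 1) (toℚᵘ-/ a n) ⟩
  (+ n ℚᵘ./ 1) ℚᵘ.* (a ℚᵘ./ n)           ≈⟨ ℚᵘ.*≡* (trans (lemma (+ n) a) (cong (λ k → a ℤ.* + suc k) (sym (ℕP.+-identityʳ m)))) ⟩
  a ℚᵘ./ 1                               ≈⟨ toℚᵘ-/ a 1 ⟨
  ℚ.toℚᵘ (q a)                           ∎)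
  where
  open ℚᵘP.≃-Reasoning
  lemma : ∀ k a → (k ℤ.* a) ℤ.* + 1 ≡ a ℤ.* k
  lemma = solveℤ

q[n]*-cancelˡ : ∀ n .{{_ : ℕ.NonZero n}} {x y} → q (+ n) * x ≡ q (+ n) * y → x ≡ y
q[n]*-cancelˡ n {x} {y} nx≡ny = begin
  x                      ≡⟨ ℚP.*-identityˡ x ⟨
  1ℚ * x                 ≡⟨ cong (_* x) n⁻¹*n≡1 ⟨
  (n⁻¹ * q (+ n)) * x    ≡⟨ ℚP.*-assoc n⁻¹ (q (+ n)) x ⟩
  n⁻¹ * (q (+ n) * x)    ≡⟨ cong (n⁻¹ *_) nx≡ny ⟩
  n⁻¹ * (q (+ n) * y)    ≡⟨ ℚP.*-assoc n⁻¹ (q (+ n)) y ⟨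
  (n⁻¹ * q (+ n)) * y    ≡⟨ cong (_* y) n⁻¹*n≡1 ⟩
  1ℚ * y                 ≡⟨ ℚP.*-identityˡ y ⟩
  y                      ∎
  where
  open ≡-Reasoning
  n⁻¹ = + 1 ℚ./ n
  n⁻¹*n≡1 : n⁻¹ * q (+ n) ≡ 1ℚ
  n⁻¹*n≡1 = trans (ℚP.*-comm n⁻¹ (q (+ n))) (q*[a/n]≡q[a] (+ 1) n)

q[n]*x≡0⇒x≡0 : ∀ n .{{_ : ℕ.NonZero n}} {x} → q (+ n) * x ≡ 0ℚ → x ≡ 0ℚ
q[n]*x≡0⇒x≡0 n nx≡0 = q[n]*-cancelˡ n (trans nx≡0 (sym (ℚP.*-zeroʳ (q (+ n)))))

*-*-swapʳ : ∀ x y z → x * y * z ≡ x * (z * y)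
*-*-swapʳ x y z = trans (ℚP.*-assoc x y z) (cong (x *_) (ℚP.*-comm y z))

pow2ℤ-suc : ∀ e → pow2ℤ (ℤ.suc e) ≡ q (+ 2) * pow2ℤ e
pow2ℤ-suc (+ k)            = refl
pow2ℤ-suc -[1+ zero ]      = refl
pow2ℤ-suc -[1+ suc k ]     = begin
  pow½ (suc k)                     ≡⟨ ℚP.*-identityˡ (pow½ (suc k)) ⟨
  (q (+ 2) * ℚ.½) * pow½ (suc k)   ≡⟨ ℚP.*-assoc (q (+ 2)) ℚ.½ (pow½ (suc k)) ⟩
  q (+ 2) * pow½ (suc (suc k))     ∎
  where open ≡-Reasoning

-- Generalized binomial coefficients

falling-absorb : ∀ a ℓ → falling (ℤ.suc a) (suc ℓ) ≡ ℤ.suc a ℤ.* falling a ℓ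
falling-absorb a zero    = lemma a
  where
  lemma : ∀ a → + 1 ℤ.* ((+ 1 ℤ.+ a) ℤ.- + 0) ≡ (+ 1 ℤ.+ a) ℤ.* + 1
  lemma = solveℤ
falling-absorb a (suc ℓ) = begin
  falling (ℤ.suc a) (suc ℓ) ℤ.* (ℤ.suc a ℤ.- + suc ℓ) ≡⟨ cong (ℤ._* (ℤ.suc a ℤ.- + suc ℓ)) (falling-absorb a ℓ) ⟩
  ℤ.suc a ℤ.* falling a ℓ ℤ.* (ℤ.suc a ℤ.- + suc ℓ)   ≡⟨ lemma a (+ ℓ) (falling a ℓ) ⟩
  ℤ.suc a ℤ.* (falling a ℓ ℤ.* (a ℤ.- + ℓ))           ∎
  where
  open ≡-Reasoning
  lemma : ∀ a x F → (+ 1 ℤ.+ a) ℤ.* F ℤ.* ((+ 1 ℤ.+ a) ℤ.- (+ 1 ℤ.+ x)) ≡ (+ 1 ℤ.+ a) ℤ.* (F ℤ.* (a ℤ.- x))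
  lemma = solveℤ

q[ℓ!]*binomℤ : ∀ a ℓ → q (+ (ℓ !)) * binomℤ a ℓ ≡ q (falling a ℓ)
q[ℓ!]*binomℤ a ℓ = q*[a/n]≡q[a] (falling a ℓ) (ℓ !) {{ℓ ℕP.!≢0}}

q[ℓ!]*[q[1+ℓ]*x] : ∀ ℓ x → q (+ (ℓ !)) * (q (+ suc ℓ) * x) ≡ q (+ (suc ℓ !)) * x
q[ℓ!]*[q[1+ℓ]*x] ℓ x = begin
  q (+ (ℓ !)) * (q (+ suc ℓ) * x)       ≡⟨ ℚP.*-assoc (q (+ (ℓ !))) _ x ⟨
  (q (+ (ℓ !)) * q (+ suc ℓ)) * x       ≡⟨ cong (_* x) (ℚP.*-comm (q (+ (ℓ !))) _) ⟩
  (q (+ suc ℓ) * q (+ (ℓ !))) * x       ≡⟨ cong (_* x) (q-* (+ suc ℓ) (+ (ℓ !))) ⟨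
  q (+ suc ℓ ℤ.* + (ℓ !)) * x           ≡⟨ cong (λ k → q k * x) (ℤP.pos-* (suc ℓ) (ℓ !)) ⟨
  q (+ (suc ℓ !)) * x                   ∎
  where open ≡-Reasoning

binomℤ-suc : ∀ a ℓ → q (+ suc ℓ) * binomℤ a (suc ℓ) ≡ q (a ℤ.- + ℓ) * binomℤ a ℓ
binomℤ-suc a ℓ = q[n]*-cancelˡ (ℓ !) {{ℓ ℕP.!≢0}} (begin
  q (+ (ℓ !)) * (q (+ suc ℓ) * binomℤ a (suc ℓ))   ≡⟨ q[ℓ!]*[q[1+ℓ]*x] ℓ _ ⟩
  q (+ (suc ℓ !)) * binomℤ a (suc ℓ)               ≡⟨ q[ℓ!]*binomℤ a (suc ℓ) ⟩
  q (falling a ℓ ℤ.* (a ℤ.- + ℓ))                  ≡⟨ q-* (falling a ℓ) _ ⟩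
  q (falling a ℓ) * q (a ℤ.- + ℓ)                  ≡⟨ cong (_* q (a ℤ.- + ℓ)) (q[ℓ!]*binomℤ a ℓ) ⟨
  q (+ (ℓ !)) * binomℤ a ℓ * q (a ℤ.- + ℓ)         ≡⟨ *-*-swapʳ (q (+ (ℓ !))) _ _ ⟩
  q (+ (ℓ !)) * (q (a ℤ.- + ℓ) * binomℤ a ℓ)       ∎)
  where open ≡-Reasoning

binomℤ-absorb : ∀ a ℓ → q (+ suc ℓ) * binomℤ (ℤ.suc a) (suc ℓ) ≡ q (ℤ.suc a) * binomℤ a ℓ
binomℤ-absorb a ℓ = q[n]*-cancelˡ (ℓ !) {{ℓ ℕP.!≢0}} (begin
  q (+ (ℓ !)) * (q (+ suc ℓ) * binomℤ (ℤ.suc a) (suc ℓ)) ≡⟨ q[ℓ!]*[q[1+ℓ]*x] ℓ _ ⟩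
  q (+ (suc ℓ !)) * binomℤ (ℤ.suc a) (suc ℓ)             ≡⟨ q[ℓ!]*binomℤ (ℤ.suc a) (suc ℓ) ⟩
  q (falling (ℤ.suc a) (suc ℓ))                          ≡⟨ cong q (falling-absorb a ℓ) ⟩
  q (ℤ.suc a ℤ.* falling a ℓ)                            ≡⟨ q-* (ℤ.suc a) (falling a ℓ) ⟩
  q (ℤ.suc a) * q (falling a ℓ)                          ≡⟨ cong (q (ℤ.suc a) *_) (q[ℓ!]*binomℤ a ℓ) ⟨
  q (ℤ.suc a) * (q (+ (ℓ !)) * binomℤ a ℓ)               ≡⟨ ℚP.*-comm (q (ℤ.suc a)) _ ⟩
  q (+ (ℓ !)) * binomℤ a ℓ * q (ℤ.suc a)                 ≡⟨ *-*-swapʳ (q (+ (ℓ !))) _ _ ⟩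
  q (+ (ℓ !)) * (q (ℤ.suc a) * binomℤ a ℓ)               ∎)
  where open ≡-Reasoning

binomℤ-pascal : ∀ a ℓ → binomℤ (ℤ.suc a) (suc ℓ) ≡ binomℤ a (suc ℓ) + binomℤ a ℓ
binomℤ-pascal a ℓ = q[n]*-cancelˡ (suc ℓ) (begin
  q (+ suc ℓ) * binomℤ (ℤ.suc a) (suc ℓ)                     ≡⟨ binomℤ-absorb a ℓ ⟩
  q (ℤ.suc a) * binomℤ a ℓ                                   ≡⟨ cong (λ k → q k * binomℤ a ℓ) (regroup a (+ ℓ)) ⟩
  q ((a ℤ.- + ℓ) ℤ.+ + suc ℓ) * binomℤ a ℓ                   ≡⟨ cong (_* binomℤ a ℓ) (q-+ (a ℤ.- + ℓ) (+ suc ℓ)) ⟩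
  (q (a ℤ.- + ℓ) + q (+ suc ℓ)) * binomℤ a ℓ                 ≡⟨ ℚP.*-distribʳ-+ (binomℤ a ℓ) (q (a ℤ.- + ℓ)) (q (+ suc ℓ)) ⟩
  q (a ℤ.- + ℓ) * binomℤ a ℓ + q (+ suc ℓ) * binomℤ a ℓ      ≡⟨ cong (_+ q (+ suc ℓ) * binomℤ a ℓ) (binomℤ-suc a ℓ) ⟨
  q (+ suc ℓ) * binomℤ a (suc ℓ) + q (+ suc ℓ) * binomℤ a ℓ  ≡⟨ ℚP.*-distribˡ-+ (q (+ suc ℓ)) _ _ ⟨
  q (+ suc ℓ) * (binomℤ a (suc ℓ) + binomℤ a ℓ)              ∎)
  where
  open ≡-Reasoning
  regroup : ∀ a x → + 1 ℤ.+ a ≡ (a ℤ.- x) ℤ.+ (+ 1 ℤ.+ x)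
  regroup = solveℤ


∑< : ℕ → (ℕ → ℚ) → ℚ
∑< zero    h = 0ℚ
∑< (suc n) h = h 0 + ∑< n (h ∘ suc)

sumℚ-map-applyUpTo : ∀ (h : ℕ → ℚ) (g : ℕ → ℕ) n → sumℚ (map h (applyUpTo g n)) ≡ ∑< n (h ∘ g)
sumℚ-map-applyUpTo h g zero    = refl
sumℚ-map-applyUpTo h g (suc n) = cong (_+_ (h (g 0))) (sumℚ-map-applyUpTo h (g ∘ suc) n)

∑<-cong< : ∀ n {h h′} → (∀ i → i < n → h i ≡ h′ i) → ∑< n h ≡ ∑< n h′
∑<-cong< zero    eq = refl
∑<-cong< (suc n) eq = cong₂ _+_ (eq 0 (s≤s z≤n)) (∑<-cong< n (λ i i<n → eq (suc i) (s≤s i<n)))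

∑<-cong : ∀ n {h h′} → (∀ i → h i ≡ h′ i) → ∑< n h ≡ ∑< n h′
∑<-cong n eq = ∑<-cong< n (λ i _ → eq i)

∑<-+ : ∀ n h h′ → ∑< n (λ i → h i + h′ i) ≡ ∑< n h + ∑< n h′
∑<-+ zero    h h′ = sym (ℚP.+-identityʳ 0ℚ)
∑<-+ (suc n) h h′ = trans (cong (_+_ (h 0 + h′ 0)) (∑<-+ n (h ∘ suc) (h′ ∘ suc)))
                          (+-+-interchange (h 0) (h′ 0) _ _)
  where
  +-+-interchange : ∀ x y u v → (x + y) + (u + v) ≡ (x + u) + (y + v)
  +-+-interchange = solveℚ ℚ-ring

∑<-*ˡ : ∀ n c h → ∑< n (λ i → c * h i) ≡ c * ∑< n h
∑<-*ˡ zero    c h = sym (ℚP.*-zeroʳ c)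
∑<-*ˡ (suc n) c h = trans (cong (_+_ (c * h 0)) (∑<-*ˡ n c (h ∘ suc))) (sym (ℚP.*-distribˡ-+ c _ _))

∑<-zero : ∀ n {h} → (∀ i → h i ≡ 0ℚ) → ∑< n h ≡ 0ℚ
∑<-zero zero    h≡0 = refl
∑<-zero (suc n) h≡0 = trans (cong₂ _+_ (h≡0 0) (∑<-zero n (h≡0 ∘ suc))) (ℚP.+-identityʳ 0ℚ)

∑<-suc : ∀ n h → ∑< (suc n) h ≡ ∑< n h + h n
∑<-suc zero    h = trans (ℚP.+-identityʳ (h 0)) (sym (ℚP.+-identityˡ (h 0)))
∑<-suc (suc n) h = trans (cong (_+_ (h 0)) (∑<-suc n (h ∘ suc))) (sym (ℚP.+-assoc (h 0) _ _))

⊛-as-∑< : ∀ f g k → (f ⊛ g) k ≡ ∑< (suc k) (λ i → f i * g (k ∸ i))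
⊛-as-∑< f g k = sumℚ-map-applyUpTo (λ i → f i * g (k ∸ i)) (λ i → i) (suc k)

tail : PS → PS
tail f i = f (suc i)

⊛-zero : ∀ f g → (f ⊛ g) 0 ≡ f 0 * g 0
⊛-zero f g = ℚP.+-identityʳ (f 0 * g 0)

⊛-sucˡ : ∀ f g k → (f ⊛ g) (suc k) ≡ f 0 * g (suc k) + (tail f ⊛ g) k
⊛-sucˡ f g k = trans (⊛-as-∑< f g (suc k)) (cong (_+_ (f 0 * g (suc k))) (sym (⊛-as-∑< (tail f) g k)))

⊛-sucʳ : ∀ f g k → (f ⊛ g) (suc k) ≡ f (suc k) * g 0 + (f ⊛ tail g) k
⊛-sucʳ f g k = begin
  (f ⊛ g) (suc k)                                           ≡⟨ ⊛-as-∑< f g (suc k) ⟩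
  ∑< (suc (suc k)) h                                        ≡⟨ ∑<-suc (suc k) h ⟩
  ∑< (suc k) h + h (suc k)                                  ≡⟨ cong₂ _+_ (∑<-cong< (suc k) index-shift) (cong (λ j → f (suc k) * g j) (ℕP.n∸n≡0 k)) ⟩
  ∑< (suc k) (λ i → f i * tail g (k ∸ i)) + f (suc k) * g 0 ≡⟨ ℚP.+-comm _ (f (suc k) * g 0) ⟩
  f (suc k) * g 0 + ∑< (suc k) (λ i → f i * tail g (k ∸ i)) ≡⟨ cong (_+_ (f (suc k) * g 0)) (⊛-as-∑< f (tail g) k) ⟨
  f (suc k) * g 0 + (f ⊛ tail g) k                          ∎
  where
  open ≡-Reasoning
  h : ℕ → ℚ
  h i = f i * g (suc k ∸ i)
  index-shift : ∀ i → i < suc k → h i ≡ f i * tail g (k ∸ i)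
  index-shift i (s≤s i≤k) = cong (λ j → f i * g j) (ℕP.+-∸-assoc 1 i≤k)

⊛-zeroˡ : ∀ f g → (∀ i → f i ≡ 0ℚ) → ∀ k → (f ⊛ g) k ≡ 0ℚ
⊛-zeroˡ f g f≡0 k = trans (⊛-as-∑< f g k)
  (∑<-zero (suc k) (λ i → trans (cong (_* g (k ∸ i)) (f≡0 i)) (ℚP.*-zeroˡ (g (k ∸ i)))))

𝟘 𝟙 : PS
𝟘 = const 0ℚ
𝟙 = const 1ℚ

𝟘≡0 : ∀ k → 𝟘 k ≡ 0ℚ
𝟘≡0 zero    = refl
𝟘≡0 (suc k) = refl

≋-refl : ∀ {f} → f ≋ f
≋-refl k = refl

≋-sym : ∀ {f g} → f ≋ g → g ≋ f
≋-sym f≋g k = sym (f≋g k)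

≋-trans : ∀ {f g h} → f ≋ g → g ≋ h → f ≋ h
≋-trans f≋g g≋h k = trans (f≋g k) (g≋h k)

⊕-cong : ∀ {f f′ g g′} → f ≋ f′ → g ≋ g′ → f ⊕ g ≋ f′ ⊕ g′
⊕-cong f≋f′ g≋g′ k = cong₂ _+_ (f≋f′ k) (g≋g′ k)

⊖-cong : ∀ {f g} → f ≋ g → ⊖ f ≋ ⊖ g
⊖-cong f≋g k = cong -_ (f≋g k)

⊛-cong : ∀ {f f′ g g′} → f ≋ f′ → g ≋ g′ → f ⊛ g ≋ f′ ⊛ g′
⊛-cong {f} {f′} {g} {g′} f≋f′ g≋g′ k = begin
  (f ⊛ g) k                               ≡⟨ ⊛-as-∑< f g k ⟩
  ∑< (suc k) (λ i → f i * g (k ∸ i))      ≡⟨ ∑<-cong (suc k) (λ i → cong₂ _*_ (f≋f′ i) (g≋g′ (k ∸ i))) ⟩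
  ∑< (suc k) (λ i → f′ i * g′ (k ∸ i))    ≡⟨ ⊛-as-∑< f′ g′ k ⟨
  (f′ ⊛ g′) k                             ∎
  where open ≡-Reasoning

⊛-distribˡ : ∀ f g h → f ⊛ (g ⊕ h) ≋ f ⊛ g ⊕ f ⊛ h
⊛-distribˡ f g h k = begin
  (f ⊛ (g ⊕ h)) k
    ≡⟨ ⊛-as-∑< f (g ⊕ h) k ⟩
  ∑< (suc k) (λ i → f i * (g (k ∸ i) + h (k ∸ i)))
    ≡⟨ ∑<-cong (suc k) (λ i → ℚP.*-distribˡ-+ (f i) (g (k ∸ i)) (h (k ∸ i))) ⟩
  ∑< (suc k) (λ i → f i * g (k ∸ i) + f i * h (k ∸ i))
    ≡⟨ ∑<-+ (suc k) (λ i → f i * g (k ∸ i)) (λ i → f i * h (k ∸ i)) ⟩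
  ∑< (suc k) (λ i → f i * g (k ∸ i)) + ∑< (suc k) (λ i → f i * h (k ∸ i))
    ≡⟨ cong₂ _+_ (⊛-as-∑< f g k) (⊛-as-∑< f h k) ⟨
  (f ⊛ g ⊕ f ⊛ h) k ∎
  where open ≡-Reasoning

·-⊛ : ∀ c f g → (c · f) ⊛ g ≋ c · (f ⊛ g)
·-⊛ c f g k = begin
  ((c · f) ⊛ g) k                               ≡⟨ ⊛-as-∑< (c · f) g k ⟩
  ∑< (suc k) (λ i → c * f i * g (k ∸ i))        ≡⟨ ∑<-cong (suc k) (λ i → ℚP.*-assoc c (f i) (g (k ∸ i))) ⟩
  ∑< (suc k) (λ i → c * (f i * g (k ∸ i)))      ≡⟨ ∑<-*ˡ (suc k) c (λ i → f i * g (k ∸ i)) ⟩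
  c * ∑< (suc k) (λ i → f i * g (k ∸ i))        ≡⟨ cong (c *_) (⊛-as-∑< f g k) ⟨
  (c · (f ⊛ g)) k                               ∎
  where open ≡-Reasoning

const-⊛ : ∀ c f → const c ⊛ f ≋ c · f
const-⊛ c f zero    = ⊛-zero (const c) f
const-⊛ c f (suc k) = begin
  (const c ⊛ f) (suc k)                    ≡⟨ ⊛-sucˡ (const c) f k ⟩
  c * f (suc k) + (tail (const c) ⊛ f) k   ≡⟨ cong (_+_ (c * f (suc k))) (⊛-zeroˡ (tail (const c)) f (λ _ → refl) k) ⟩
  c * f (suc k) + 0ℚ                       ≡⟨ ℚP.+-identityʳ _ ⟩
  c * f (suc k)                            ∎
  where open ≡-Reasoning

⊛-comm : ∀ f g → f ⊛ g ≋ g ⊛ f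
⊛-comm f g zero    = trans (⊛-zero f g) (trans (ℚP.*-comm (f 0) (g 0)) (sym (⊛-zero g f)))
⊛-comm f g (suc k) = begin
  (f ⊛ g) (suc k)                   ≡⟨ ⊛-sucˡ f g k ⟩
  f 0 * g (suc k) + (tail f ⊛ g) k  ≡⟨ cong₂ _+_ (ℚP.*-comm (f 0) _) (⊛-comm (tail f) g k) ⟩
  g (suc k) * f 0 + (g ⊛ tail f) k  ≡⟨ ⊛-sucʳ g f k ⟨
  (g ⊛ f) (suc k)                   ∎
  where open ≡-Reasoning

⊛-distribʳ : ∀ f g h → (g ⊕ h) ⊛ f ≋ g ⊛ f ⊕ h ⊛ f
⊛-distribʳ f g h k = trans (⊛-comm (g ⊕ h) f k)
  (trans (⊛-distribˡ f g h k) (cong₂ _+_ (⊛-comm f g k) (⊛-comm f h k)))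

⊛-assoc : ∀ f g h → (f ⊛ g) ⊛ h ≋ f ⊛ (g ⊛ h)
⊛-assoc f g h zero    = begin
  ((f ⊛ g) ⊛ h) 0      ≡⟨ trans (⊛-zero (f ⊛ g) h) (cong (_* h 0) (⊛-zero f g)) ⟩
  f 0 * g 0 * h 0      ≡⟨ ℚP.*-assoc (f 0) (g 0) (h 0) ⟩
  f 0 * (g 0 * h 0)    ≡⟨ trans (⊛-zero f (g ⊛ h)) (cong (f 0 *_) (⊛-zero g h)) ⟨
  (f ⊛ (g ⊛ h)) 0      ∎
  where open ≡-Reasoning
⊛-assoc f g h (suc k) = begin
  ((f ⊛ g) ⊛ h) (suc k)
    ≡⟨ ⊛-sucˡ (f ⊛ g) h k ⟩
  (f ⊛ g) 0 * h (suc k) + (tail (f ⊛ g) ⊛ h) k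
    ≡⟨ cong₂ _+_ (cong (_* h (suc k)) (⊛-zero f g)) (⊛-cong {g = h} (⊛-sucˡ f g) ≋-refl k) ⟩
  f 0 * g 0 * h (suc k) + ((f 0 · tail g ⊕ tail f ⊛ g) ⊛ h) k
    ≡⟨ cong (_+_ (f 0 * g 0 * h (suc k))) (trans (⊛-distribʳ h (f 0 · tail g) (tail f ⊛ g) k)
                                          (cong₂ _+_ (·-⊛ (f 0) (tail g) h k) (⊛-assoc (tail f) g h k))) ⟩
  f 0 * g 0 * h (suc k) + (f 0 * (tail g ⊛ h) k + (tail f ⊛ (g ⊛ h)) k)
    ≡⟨ regroup (f 0) (g 0) (h (suc k)) _ _ ⟩
  f 0 * (g 0 * h (suc k) + (tail g ⊛ h) k) + (tail f ⊛ (g ⊛ h)) k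
    ≡⟨ cong (λ t → f 0 * t + (tail f ⊛ (g ⊛ h)) k) (⊛-sucˡ g h k) ⟨
  f 0 * (g ⊛ h) (suc k) + (tail f ⊛ (g ⊛ h)) k
    ≡⟨ ⊛-sucˡ f (g ⊛ h) k ⟨
  (f ⊛ (g ⊛ h)) (suc k) ∎
  where
  open ≡-Reasoning
  regroup : ∀ a b c x y → a * b * c + (a * x + y) ≡ a * (b * c + x) + y
  regroup = solveℚ ℚ-ring

⊛-identityˡ : ∀ f → 𝟙 ⊛ f ≋ f
⊛-identityˡ f k = trans (const-⊛ 1ℚ f k) (ℚP.*-identityˡ (f k))

zS-⊛-suc : ∀ f k → (zS ⊛ f) (suc k) ≡ f k
zS-⊛-suc f k = begin
  (zS ⊛ f) (suc k)                  ≡⟨ ⊛-sucˡ zS f k ⟩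
  0ℚ * f (suc k) + (tail zS ⊛ f) k  ≡⟨ cong₂ _+_ (ℚP.*-zeroˡ (f (suc k))) (⊛-cong {g = f} tail-zS≋𝟙 ≋-refl k) ⟩
  0ℚ + (𝟙 ⊛ f) k                    ≡⟨ trans (ℚP.+-identityˡ _) (⊛-identityˡ f k) ⟩
  f k                               ∎
  where
  open ≡-Reasoning
  tail-zS≋𝟙 : tail zS ≋ 𝟙
  tail-zS≋𝟙 zero    = refl
  tail-zS≋𝟙 (suc i) = refl

PS-isCommutativeRing : IsCommutativeRing _≋_ _⊕_ _⊛_ ⊖_ 𝟘 𝟙
PS-isCommutativeRing = record
  { isRing = record
    { +-isAbelianGroup = record
      { isGroup = record
        { isMonoid = record
          { isSemigroup = record
            { isMagma = record
              { isEquivalence = record { refl = ≋-refl ; sym = ≋-sym ; trans = ≋-trans }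
              ; ∙-cong = ⊕-cong }
            ; assoc = λ f g h k → ℚP.+-assoc (f k) (g k) (h k) }
          ; identity = (λ f k → trans (cong (_+ f k) (𝟘≡0 k)) (ℚP.+-identityˡ (f k)))
                     , (λ f k → trans (cong (_+_ (f k)) (𝟘≡0 k)) (ℚP.+-identityʳ (f k))) }
        ; inverse = (λ f k → trans (ℚP.+-inverseˡ (f k)) (sym (𝟘≡0 k)))
                  , (λ f k → trans (ℚP.+-inverseʳ (f k)) (sym (𝟘≡0 k)))
        ; ⁻¹-cong = ⊖-cong }
      ; comm = λ f g k → ℚP.+-comm (f k) (g k) }
    ; *-cong = ⊛-cong
    ; *-assoc = ⊛-assoc
    ; *-identity = ⊛-identityˡ , (λ f → ≋-trans (⊛-comm f 𝟙) (⊛-identityˡ f))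
    ; distrib = ⊛-distribˡ , ⊛-distribʳ }
  ; *-comm = ⊛-comm }

PS-commutativeRing : CommutativeRing 0ℓ 0ℓ
PS-commutativeRing = record { isCommutativeRing = PS-isCommutativeRing }

PS-almostCommutativeRing : ACR.AlmostCommutativeRing 0ℓ 0ℓ
PS-almostCommutativeRing = ACR.fromCommutativeRing PS-commutativeRing

const-homomorphism : ℚ.+-*-rawRing ACR.-Raw-AlmostCommutative⟶ PS-almostCommutativeRing
const-homomorphism = record
  { ⟦_⟧    = const
  ; +-homo = λ a b → λ { zero → refl ; (suc k) → sym (ℚP.+-identityʳ 0ℚ) }
  ; *-homo = λ a b k → sym (trans (const-⊛ a (const b) k) (·-const a b k))
  ; -‿homo = λ a → λ { zero → refl ; (suc k) → refl }
  ; 0-homo = λ k → refl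
  ; 1-homo = λ k → refl
  }
  where
  ·-const : ∀ a b k → a * const b k ≡ const (a * b) k
  ·-const a b zero    = refl
  ·-const a b (suc k) = ℚP.*-zeroʳ a

const-≟ : WeaklyDecidable (ACR.Induced-equivalence const-homomorphism)
const-≟ a b with a ℚP.≟ b
... | yes a≡b = just (λ k → cong (λ c → const c k) a≡b)
... | no  _   = nothing

open Algebra.Solver.Ring ℚ.+-*-rawRing PS-almostCommutativeRing const-homomorphism const-≟
  using (solve; _:=_; _:+_; _:*_; _:-_; :-_; _:^_; con)

open ACR._-Raw-AlmostCommutative⟶_ const-homomorphism using () renaming (+-homo to const-+; *-homo to const-*)

module ≋-Reasoning = Relation.Binary.Reasoning.Setoid (CommutativeRing.setoid PS-commutativeRing)

const-⊛-const-⊛ : ∀ a b f k → ((const a ⊛ const b) ⊛ f) k ≡ a * b * f k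
const-⊛-const-⊛ a b f k = trans (⊛-cong {g = f} (≋-sym (const-* a b)) ≋-refl k) (const-⊛ (a * b) f k)

^S-cong : ∀ {f g} n → f ≋ g → f ^S n ≋ g ^S n
^S-cong zero    f≋g = ≋-refl
^S-cong (suc n) f≋g = ⊛-cong f≋g (^S-cong n f≋g)

-- The Euler operator θ = z d/dz

θ : PS → PS
θ f k = q (+ k) * f k

θ-cong : ∀ {f g} → f ≋ g → θ f ≋ θ g
θ-cong f≋g k = cong (q (+ k) *_) (f≋g k)

θ-⊕ : ∀ f g → θ (f ⊕ g) ≋ θ f ⊕ θ g
θ-⊕ f g k = ℚP.*-distribˡ-+ (q (+ k)) (f k) (g k)

θ-⊖ : ∀ f → θ (⊖ f) ≋ ⊖ θ f
θ-⊖ f k = sym (ℚP.neg-distribʳ-* (q (+ k)) (f k))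

θ-const : ∀ c → θ (const c) ≋ 𝟘
θ-const c zero    = ℚP.*-zeroˡ c
θ-const c (suc k) = ℚP.*-zeroʳ (q (+ suc k))

θ-zS : θ zS ≋ zS
θ-zS zero          = refl
θ-zS (suc zero)    = refl
θ-zS (suc (suc k)) = ℚP.*-zeroʳ (q (+ suc (suc k)))

θ-Leibniz : ∀ f g → θ (f ⊛ g) ≋ θ f ⊛ g ⊕ f ⊛ θ g
θ-Leibniz f g k = begin
  q (+ k) * (f ⊛ g) k
    ≡⟨ cong (q (+ k) *_) (⊛-as-∑< f g k) ⟩
  q (+ k) * ∑< (suc k) (λ i → f i * g (k ∸ i))
    ≡⟨ ∑<-*ˡ (suc k) (q (+ k)) (λ i → f i * g (k ∸ i)) ⟨
  ∑< (suc k) (λ i → q (+ k) * (f i * g (k ∸ i)))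
    ≡⟨ ∑<-cong< (suc k) (λ { i (s≤s i≤k) → split i≤k }) ⟩
  ∑< (suc k) (λ i → θ f i * g (k ∸ i) + f i * θ g (k ∸ i))
    ≡⟨ ∑<-+ (suc k) (λ i → θ f i * g (k ∸ i)) (λ i → f i * θ g (k ∸ i)) ⟩
  ∑< (suc k) (λ i → θ f i * g (k ∸ i)) + ∑< (suc k) (λ i → f i * θ g (k ∸ i))
    ≡⟨ cong₂ _+_ (⊛-as-∑< (θ f) g k) (⊛-as-∑< f (θ g) k) ⟨
  (θ f ⊛ g ⊕ f ⊛ θ g) k ∎
  where
  open ≡-Reasoning
  split : ∀ {i} → i ≤ k → q (+ k) * (f i * g (k ∸ i)) ≡ θ f i * g (k ∸ i) + f i * θ g (k ∸ i)
  split {i} i≤k = begin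
    q (+ k) * (f i * g (k ∸ i))                         ≡⟨ cong (λ n → q (+ n) * (f i * g (k ∸ i))) (ℕP.m+[n∸m]≡n i≤k) ⟨
    q (+ i ℤ.+ + (k ∸ i)) * (f i * g (k ∸ i))           ≡⟨ cong (_* (f i * g (k ∸ i))) (q-+ (+ i) (+ (k ∸ i))) ⟩
    (q (+ i) + q (+ (k ∸ i))) * (f i * g (k ∸ i))       ≡⟨ distribute (q (+ i)) (q (+ (k ∸ i))) (f i) (g (k ∸ i)) ⟩
    q (+ i) * f i * g (k ∸ i) + f i * (q (+ (k ∸ i)) * g (k ∸ i)) ∎
    where
    distribute : ∀ a b x y → (a + b) * (x * y) ≡ a * x * y + x * (b * y)
    distribute = solveℚ ℚ-ring

θ-const-⊛ : ∀ c f → θ (const c ⊛ f) ≋ const c ⊛ θ f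
θ-const-⊛ c f = begin
  θ (const c ⊛ f)                        ≈⟨ θ-Leibniz (const c) f ⟩
  θ (const c) ⊛ f ⊕ const c ⊛ θ f        ≈⟨ ⊕-cong {g = const c ⊛ θ f} (⊛-cong {g = f} (θ-const c) ≋-refl) ≋-refl ⟩
  𝟘 ⊛ f ⊕ const c ⊛ θ f                  ≈⟨ solve 2 (λ f f′ → con 0ℚ :* f :+ f′ := f′) ≋-refl f (const c ⊛ θ f) ⟩
  const c ⊛ θ f                          ∎
  where open ≋-Reasoning

θ-^S-suc : ∀ w N → θ (w ^S suc N) ≋ const (q (+ suc N)) ⊛ (w ^S N ⊛ θ w)
θ-^S-suc w zero    = begin
  θ (w ⊛ 𝟙)
    ≈⟨ θ-Leibniz w 𝟙 ⟩
  θ w ⊛ 𝟙 ⊕ w ⊛ θ 𝟙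
    ≈⟨ ⊕-cong {f = θ w ⊛ 𝟙} ≋-refl (⊛-cong {f = w} ≋-refl (θ-const 1ℚ)) ⟩
  θ w ⊛ 𝟙 ⊕ w ⊛ 𝟘
    ≈⟨ solve 2 (λ w′ w → w′ :* con 1ℚ :+ w :* con 0ℚ := con 1ℚ :* (con 1ℚ :* w′)) ≋-refl (θ w) w ⟩
  const 1ℚ ⊛ (𝟙 ⊛ θ w) ∎
  where open ≋-Reasoning
θ-^S-suc w (suc N) = begin
  θ (w ⊛ w ^S suc N)
    ≈⟨ θ-Leibniz w (w ^S suc N) ⟩
  θ w ⊛ w ^S suc N ⊕ w ⊛ θ (w ^S suc N)
    ≈⟨ ⊕-cong {f = θ w ⊛ w ^S suc N} ≋-refl (⊛-cong {f = w} ≋-refl (θ-^S-suc w N)) ⟩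
  θ w ⊛ (w ⊛ w ^S N) ⊕ w ⊛ (const n ⊛ (w ^S N ⊛ θ w))
    ≈⟨ solve 4 (λ w′ w wᴺ n → w′ :* (w :* wᴺ) :+ w :* (n :* (wᴺ :* w′)) := (con 1ℚ :+ n) :* ((w :* wᴺ) :* w′))
               ≋-refl (θ w) w (w ^S N) (const n) ⟩
  (const 1ℚ ⊕ const n) ⊛ (w ^S suc N ⊛ θ w)
    ≈⟨ ⊛-cong {g = w ^S suc N ⊛ θ w} (const-+ 1ℚ n) ≋-refl ⟨
  const (1ℚ + n) ⊛ (w ^S suc N ⊛ θ w)
    ≡⟨ cong (λ m → const m ⊛ (w ^S suc N ⊛ θ w)) (q-suc (suc N)) ⟨
  const (q (+ suc (suc N))) ⊛ (w ^S suc N ⊛ θ w) ∎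
  where
  open ≋-Reasoning
  n = q (+ suc N)

-- Recurrences for the coefficients of powers

-- Satisfied by a N L = [z^L] wᴺ when w³ − 2w² + z = 0: shift is the cubic times wᴺ, and
-- euler is θ of the cubic times wᴺ, using θ(wᵏ⁺¹) = (k+1)·wᵏ·θw.
record Recurrences (a : ℕ → ℕ → ℚ) : Set where
  field
    shift : ∀ N L → a (3 ℕ.+ N) (suc L) + - (q (+ 2) * a (2 ℕ.+ N) (suc L)) + a N L ≡ 0ℚ
    euler : ∀ N L → (q (+ 3) * q (+ (2 ℕ.+ N))) * (q (+ suc L) * a (3 ℕ.+ N) (suc L))
                  + - ((q (+ 4) * q (+ (3 ℕ.+ N))) * (q (+ suc L) * a (2 ℕ.+ N) (suc L)))
                  + (q (+ (2 ℕ.+ N)) * q (+ (3 ℕ.+ N))) * a N L ≡ 0ℚ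

Recurrences-− : ∀ {a b} → Recurrences a → Recurrences b → Recurrences (λ N L → a N L + - b N L)
Recurrences-− {a} {b} ra rb = record
  { shift = λ N L → trans
      (shift-linear (a (3 ℕ.+ N) (suc L)) (a (2 ℕ.+ N) (suc L)) (a N L)
                    (b (3 ℕ.+ N) (suc L)) (b (2 ℕ.+ N) (suc L)) (b N L))
      (zero-difference (Recurrences.shift ra N L) (Recurrences.shift rb N L))
  ; euler = λ N L → trans
      (euler-linear (q (+ 3) * q (+ (2 ℕ.+ N))) (q (+ 4) * q (+ (3 ℕ.+ N))) (q (+ (2 ℕ.+ N)) * q (+ (3 ℕ.+ N))) (q (+ suc L))
                    (a (3 ℕ.+ N) (suc L)) (a (2 ℕ.+ N) (suc L)) (a N L)
                    (b (3 ℕ.+ N) (suc L)) (b (2 ℕ.+ N) (suc L)) (b N L))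
      (zero-difference (Recurrences.euler ra N L) (Recurrences.euler rb N L))
  }
  where
  zero-difference : ∀ {x y} → x ≡ 0ℚ → y ≡ 0ℚ → x + - y ≡ 0ℚ
  zero-difference refl refl = refl
  shift-linear : ∀ x₃ x₂ x₀ y₃ y₂ y₀ → (x₃ + - y₃) + - (q (+ 2) * (x₂ + - y₂)) + (x₀ + - y₀)
                                       ≡ (x₃ + - (q (+ 2) * x₂) + x₀) + - (y₃ + - (q (+ 2) * y₂) + y₀)
  shift-linear = solveℚ ℚ-ring
  euler-linear : ∀ α β γ Q x₃ x₂ x₀ y₃ y₂ y₀ →
                 α * (Q * (x₃ + - y₃)) + - (β * (Q * (x₂ + - y₂))) + γ * (x₀ + - y₀)
                 ≡ (α * (Q * x₃) + - (β * (Q * x₂)) + γ * x₀) + - (α * (Q * y₃) + - (β * (Q * y₂)) + γ * y₀)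
  euler-linear = solveℚ ℚ-ring

combination-zero : ∀ {t e₁ e₂ e₃} a b c → t ≡ a * e₁ + b * e₂ + c * e₃ →
                   e₁ ≡ 0ℚ → e₂ ≡ 0ℚ → e₃ ≡ 0ℚ → t ≡ 0ℚ
combination-zero a b c t≡ refl refl refl = trans t≡ (zeros a b c)
  where
  zeros : ∀ a b c → a * 0ℚ + b * 0ℚ + c * 0ℚ ≡ 0ℚ
  zeros = solveℚ ℚ-ring

[16[1+L]-24]*x≡0⇒x≡0 : ∀ L x → (q (+ 16) * q (+ suc L) + - q (+ 24)) * x ≡ 0ℚ → x ≡ 0ℚ
[16[1+L]-24]*x≡0⇒x≡0 zero     x eq = q[n]*x≡0⇒x≡0 8 (trans (minus-eight x) (cong -_ eq))
  where
  minus-eight : ∀ x → q (+ 8) * x ≡ - ((q (+ 16) * q (+ 1) + - q (+ 24)) * x)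
  minus-eight = solveℚ ℚ-ring
[16[1+L]-24]*x≡0⇒x≡0 (suc L) x eq = q[n]*x≡0⇒x≡0 (suc (L ℕ.+ L)) (q[n]*x≡0⇒x≡0 8 (begin
  q (+ 8) * (q (+ suc (L ℕ.+ L)) * x)                      ≡⟨ cong (λ t → q (+ 8) * (t * x)) (trans (q-suc (L ℕ.+ L)) (cong (_+_ 1ℚ) (q-+ (+ L) (+ L)))) ⟩
  q (+ 8) * ((1ℚ + (q (+ L) + q (+ L))) * x)               ≡⟨ regroup (q (+ L)) x ⟩
  (q (+ 16) * (q (+ 2) + q (+ L)) + - q (+ 24)) * x        ≡⟨ cong (λ t → (q (+ 16) * t + - q (+ 24)) * x) (q-+ (+ 2) (+ L)) ⟨
  (q (+ 16) * q (+ suc (suc L)) + - q (+ 24)) * x          ≡⟨ eq ⟩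
  0ℚ                                                        ∎))
  where
  open ≡-Reasoning
  regroup : ∀ l x → q (+ 8) * ((1ℚ + (l + l)) * x) ≡ (q (+ 16) * (q (+ 2) + l) + - q (+ 24)) * x
  regroup = solveℚ ℚ-ring

module _ {g : ℕ → ℕ → ℚ} (recurrences : Recurrences g) (g₀≡0 : ∀ L → g 0 L ≡ 0ℚ) where
  open Recurrences recurrences

  private
    euler′ : ∀ N L → (q (+ 3) * (q (+ 2) + q (+ N))) * (q (+ suc L) * g (3 ℕ.+ N) (suc L))
                   + - ((q (+ 4) * (q (+ 3) + q (+ N))) * (q (+ suc L) * g (2 ℕ.+ N) (suc L)))
                   + ((q (+ 2) + q (+ N)) * (q (+ 3) + q (+ N))) * g N L ≡ 0ℚ
    euler′ N L = subst₂ (λ n₂ n₃ → (q (+ 3) * n₂) * (q (+ suc L) * g (3 ℕ.+ N) (suc L))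
                                   + - ((q (+ 4) * n₃) * (q (+ suc L) * g (2 ℕ.+ N) (suc L))) + (n₂ * n₃) * g N L ≡ 0ℚ)
                        (q-+ (+ 2) (+ N)) (q-+ (+ 3) (+ N)) (euler N L)

    vanish-suc : ∀ L → (∀ N → g (2 ℕ.+ N) L ≡ 0ℚ) → ∀ N → g (2 ℕ.+ N) (suc L) ≡ 0ℚ
    vanish-suc L ih = vanish
      where
      Q = q (+ suc L)

      from-four : ∀ m → g (4 ℕ.+ m) (suc L) ≡ 0ℚ
      from-four m = q[n]*x≡0⇒x≡0 2 (q[n]*x≡0⇒x≡0 (2 ℕ.+ m) (q[n]*x≡0⇒x≡0 (suc L)
        (combination-zero (q (+ 1)) (- (q (+ 3) * (q (+ 2) + K) * Q)) (- ((q (+ 2) + K) * (q (+ 3) + K) + - (q (+ 3) * (q (+ 2) + K) * Q)))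
          (eliminate K Q (g (5 ℕ.+ m) (suc L)) (g (4 ℕ.+ m) (suc L)) (g (2 ℕ.+ m) L))
          (euler′ (2 ℕ.+ m) L) (shift (2 ℕ.+ m) L) (ih m))))
        where
        K = q (+ (2 ℕ.+ m))
        eliminate : ∀ K Q x₃ x₂ g₀ → Q * (K * (q (+ 2) * x₂))
          ≡ q (+ 1) * ((q (+ 3) * (q (+ 2) + K)) * (Q * x₃) + - ((q (+ 4) * (q (+ 3) + K)) * (Q * x₂)) + ((q (+ 2) + K) * (q (+ 3) + K)) * g₀)
            + - (q (+ 3) * (q (+ 2) + K) * Q) * (x₃ + - (q (+ 2) * x₂) + g₀)
            + - ((q (+ 2) + K) * (q (+ 3) + K) + - (q (+ 3) * (q (+ 2) + K) * Q)) * g₀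
        eliminate = solveℚ ℚ-ring

      -- g 1 L is not known to vanish, so it is eliminated between the two recurrences at
      -- N = 1; what is left is the factor 16(L+1) − 24 = 8(2L − 1), which is never zero.
      three : g 3 (suc L) ≡ 0ℚ
      three = [16[1+L]-24]*x≡0⇒x≡0 L (g 3 (suc L))
        (combination-zero (q (+ 12)) (- q (+ 1)) (q (+ 9) * Q + - q (+ 12))
          (eliminate Q (g 4 (suc L)) (g 3 (suc L)) (g 1 L))
          (shift 1 L) (euler 1 L) (from-four 0))
        where
        eliminate : ∀ Q x₄ x₃ g₁ → (q (+ 16) * Q + - q (+ 24)) * x₃
          ≡ q (+ 12) * (x₄ + - (q (+ 2) * x₃) + g₁)
            + - q (+ 1) * ((q (+ 3) * q (+ 3)) * (Q * x₄) + - ((q (+ 4) * q (+ 4)) * (Q * x₃)) + (q (+ 3) * q (+ 4)) * g₁)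
            + (q (+ 9) * Q + - q (+ 12)) * x₄
        eliminate = solveℚ ℚ-ring

      two : g 2 (suc L) ≡ 0ℚ
      two = q[n]*x≡0⇒x≡0 2
        (combination-zero (- q (+ 1)) (q (+ 1)) (q (+ 1))
          (eliminate (g 3 (suc L)) (g 2 (suc L)) (g 0 L))
          (shift 0 L) three (g₀≡0 L))
        where
        eliminate : ∀ x₃ x₂ g₀ → q (+ 2) * x₂ ≡ - q (+ 1) * (x₃ + - (q (+ 2) * x₂) + g₀) + q (+ 1) * x₃ + q (+ 1) * g₀
        eliminate = solveℚ ℚ-ring

      vanish : ∀ N → g (2 ℕ.+ N) (suc L) ≡ 0ℚ
      vanish zero          = two
      vanish (suc zero)    = three
      vanish (suc (suc m)) = from-four m

  Recurrences-vanish : (∀ N → g (2 ℕ.+ N) 0 ≡ 0ℚ) → ∀ L N → g (2 ℕ.+ N) L ≡ 0ℚ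
  Recurrences-vanish g₂₊ₙ≡0 zero    = g₂₊ₙ≡0
  Recurrences-vanish g₂₊ₙ≡0 (suc L) = vanish-suc L (Recurrences-vanish g₂₊ₙ≡0 L)

rhsℤ : ℤ → PS
rhsℤ c ℓ = pow2ℤ (c ℤ.- + (3 ℕ.* ℓ) ℤ.- + 1) * binomℤ (+ (3 ℕ.* ℓ) ℤ.- c) ℓ

rhsℤ-≡ : ∀ c ℓ {e b} → c ℤ.- + 3 ℤ.* + ℓ ℤ.- + 1 ≡ e → + 3 ℤ.* + ℓ ℤ.- c ≡ b → rhsℤ c ℓ ≡ pow2ℤ e * binomℤ b ℓ
rhsℤ-≡ c ℓ e≡ b≡ = cong₂ (λ e b → pow2ℤ e * binomℤ b ℓ)
  (trans (cong (λ t → c ℤ.- t ℤ.- + 1) (ℤP.pos-* 3 ℓ)) e≡) (trans (cong (ℤ._- c) (ℤP.pos-* 3 ℓ)) b≡)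

rhsℤ-zero : ∀ c → rhsℤ c 0 ≡ pow2ℤ (ℤ.pred c)
rhsℤ-zero c = trans (rhsℤ-≡ c 0 (exponent c) refl) (ℚP.*-identityʳ _)
  where
  exponent : ∀ c → c ℤ.- + 3 ℤ.* + 0 ℤ.- + 1 ≡ ℤ.- + 1 ℤ.+ c
  exponent = solveℤ

module _ (c : ℤ) (ℓ : ℕ) where
  private
    x d b : ℤ
    x = + ℓ
    d = c ℤ.- + 3 ℤ.* x ℤ.- + 2
    b = + 3 ℤ.* x ℤ.- c

  rhsℤ[3+c,1+ℓ] : rhsℤ (+ 3 ℤ.+ c) (suc ℓ) ≡ pow2ℤ (ℤ.suc d) * binomℤ b (suc ℓ)
  rhsℤ[3+c,1+ℓ] = rhsℤ-≡ (+ 3 ℤ.+ c) (suc ℓ) (exponent c x) (index c x)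
    where
    exponent : ∀ c x → (+ 3 ℤ.+ c) ℤ.- + 3 ℤ.* (+ 1 ℤ.+ x) ℤ.- + 1 ≡ + 1 ℤ.+ (c ℤ.- + 3 ℤ.* x ℤ.- + 2)
    exponent = solveℤ
    index : ∀ c x → + 3 ℤ.* (+ 1 ℤ.+ x) ℤ.- (+ 3 ℤ.+ c) ≡ + 3 ℤ.* x ℤ.- c
    index = solveℤ

  rhsℤ[2+c,1+ℓ] : rhsℤ (+ 2 ℤ.+ c) (suc ℓ) ≡ pow2ℤ d * binomℤ (ℤ.suc b) (suc ℓ)
  rhsℤ[2+c,1+ℓ] = rhsℤ-≡ (+ 2 ℤ.+ c) (suc ℓ) (exponent c x) (index c x)
    where
    exponent : ∀ c x → (+ 2 ℤ.+ c) ℤ.- + 3 ℤ.* (+ 1 ℤ.+ x) ℤ.- + 1 ≡ c ℤ.- + 3 ℤ.* x ℤ.- + 2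
    exponent = solveℤ
    index : ∀ c x → + 3 ℤ.* (+ 1 ℤ.+ x) ℤ.- (+ 2 ℤ.+ c) ≡ + 1 ℤ.+ (+ 3 ℤ.* x ℤ.- c)
    index = solveℤ

  rhsℤ[c,ℓ] : rhsℤ c ℓ ≡ pow2ℤ (ℤ.suc d) * binomℤ b ℓ
  rhsℤ[c,ℓ] = rhsℤ-≡ c ℓ (exponent c x) refl
    where
    exponent : ∀ c x → c ℤ.- + 3 ℤ.* x ℤ.- + 1 ≡ + 1 ℤ.+ (c ℤ.- + 3 ℤ.* x ℤ.- + 2)
    exponent = solveℤ

  rhsℤ-pascal : rhsℤ (+ 3 ℤ.+ c) (suc ℓ) + - (q (+ 2) * rhsℤ (+ 2 ℤ.+ c) (suc ℓ)) + rhsℤ c ℓ ≡ 0ℚ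
  rhsℤ-pascal = begin
    rhsℤ (+ 3 ℤ.+ c) (suc ℓ) + - (q (+ 2) * rhsℤ (+ 2 ℤ.+ c) (suc ℓ)) + rhsℤ c ℓ
      ≡⟨ cong₂ (λ r₃ r₂ → r₃ + - (q (+ 2) * r₂) + rhsℤ c ℓ) rhsℤ[3+c,1+ℓ] rhsℤ[2+c,1+ℓ] ⟩
    pow2ℤ (ℤ.suc d) * binomℤ b (suc ℓ) + - (q (+ 2) * (pow2ℤ d * binomℤ (ℤ.suc b) (suc ℓ))) + rhsℤ c ℓ
      ≡⟨ cong₂ (λ p r₀ → p * binomℤ b (suc ℓ) + - (q (+ 2) * (pow2ℤ d * binomℤ (ℤ.suc b) (suc ℓ))) + r₀)
               (pow2ℤ-suc d) (trans rhsℤ[c,ℓ] (cong (_* binomℤ b ℓ) (pow2ℤ-suc d))) ⟩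
    q (+ 2) * pow2ℤ d * binomℤ b (suc ℓ) + - (q (+ 2) * (pow2ℤ d * binomℤ (ℤ.suc b) (suc ℓ))) + q (+ 2) * pow2ℤ d * binomℤ b ℓ
      ≡⟨ cong (λ B → q (+ 2) * pow2ℤ d * binomℤ b (suc ℓ) + - (q (+ 2) * (pow2ℤ d * B)) + q (+ 2) * pow2ℤ d * binomℤ b ℓ)
              (binomℤ-pascal b ℓ) ⟩
    q (+ 2) * pow2ℤ d * binomℤ b (suc ℓ) + - (q (+ 2) * (pow2ℤ d * (binomℤ b (suc ℓ) + binomℤ b ℓ))) + q (+ 2) * pow2ℤ d * binomℤ b ℓ
      ≡⟨ cancel (pow2ℤ d) (binomℤ b (suc ℓ)) (binomℤ b ℓ) ⟩
    0ℚ ∎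
    where
    open ≡-Reasoning
    cancel : ∀ p B₁ B₀ → q (+ 2) * p * B₁ + - (q (+ 2) * (p * (B₁ + B₀))) + q (+ 2) * p * B₀ ≡ 0ℚ
    cancel = solveℚ ℚ-ring

  rhsℤ-euler : q (+ suc ℓ) * (q (+ 3) * rhsℤ (+ 3 ℤ.+ c) (suc ℓ) + - (q (+ 4) * rhsℤ (+ 2 ℤ.+ c) (suc ℓ)))
             ≡ - (q (+ 2 ℤ.+ c) * rhsℤ c ℓ)
  rhsℤ-euler = begin
    Q * (q (+ 3) * rhsℤ (+ 3 ℤ.+ c) (suc ℓ) + - (q (+ 4) * rhsℤ (+ 2 ℤ.+ c) (suc ℓ)))
      ≡⟨ cong₂ (λ r₃ r₂ → Q * (q (+ 3) * r₃ + - (q (+ 4) * r₂))) (trans rhsℤ[3+c,1+ℓ] (cong (_* binomℤ b (suc ℓ)) (pow2ℤ-suc d))) rhsℤ[2+c,1+ℓ] ⟩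
    Q * (q (+ 3) * (q (+ 2) * p * binomℤ b (suc ℓ)) + - (q (+ 4) * (p * binomℤ (ℤ.suc b) (suc ℓ))))
      ≡⟨ distribute Q p (binomℤ b (suc ℓ)) (binomℤ (ℤ.suc b) (suc ℓ)) ⟩
    q (+ 6) * p * (Q * binomℤ b (suc ℓ)) + - (q (+ 4) * p * (Q * binomℤ (ℤ.suc b) (suc ℓ)))
      ≡⟨ cong₂ (λ B₁ B₂ → q (+ 6) * p * B₁ + - (q (+ 4) * p * B₂)) (binomℤ-suc b ℓ) (binomℤ-absorb b ℓ) ⟩
    q (+ 6) * p * (q (b ℤ.- x) * B₀) + - (q (+ 4) * p * (q (ℤ.suc b) * B₀))
      ≡⟨ cong₂ (λ u v → q (+ 6) * p * (u * B₀) + - (q (+ 4) * p * (v * B₀))) q[b-x] q[1+b] ⟩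
    q (+ 6) * p * ((q (+ 3) * q x + - q c + - q x) * B₀) + - (q (+ 4) * p * ((1ℚ + (q (+ 3) * q x + - q c)) * B₀))
      ≡⟨ collect p B₀ (q x) (q c) ⟩
    - ((q (+ 2) + q c) * (q (+ 2) * p * B₀))
      ≡⟨ cong₂ (λ u r → - (u * r)) (q-+ (+ 2) c) (trans rhsℤ[c,ℓ] (cong (_* B₀) (pow2ℤ-suc d))) ⟨
    - (q (+ 2 ℤ.+ c) * rhsℤ c ℓ) ∎
    where
    open ≡-Reasoning
    Q = q (+ suc ℓ)
    p = pow2ℤ d
    B₀ = binomℤ b ℓ
    q[b] : q b ≡ q (+ 3) * q x + - q c
    q[b] = trans (q-+ (+ 3 ℤ.* x) (ℤ.- c)) (cong₂ _+_ (q-* (+ 3) x) (q-neg c))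
    q[b-x] : q (b ℤ.- x) ≡ q (+ 3) * q x + - q c + - q x
    q[b-x] = trans (q-+ b (ℤ.- x)) (cong₂ _+_ q[b] (q-neg x))
    q[1+b] : q (ℤ.suc b) ≡ 1ℚ + (q (+ 3) * q x + - q c)
    q[1+b] = trans (q-+ (+ 1) b) (cong (_+_ 1ℚ) q[b])
    distribute : ∀ Q p B₁ B₂ → Q * (q (+ 3) * (q (+ 2) * p * B₁) + - (q (+ 4) * (p * B₂)))
                             ≡ q (+ 6) * p * (Q * B₁) + - (q (+ 4) * p * (Q * B₂))
    distribute = solveℚ ℚ-ring
    collect : ∀ p B x c → q (+ 6) * p * ((q (+ 3) * x + - c + - x) * B) + - (q (+ 4) * p * ((1ℚ + (q (+ 3) * x + - c)) * B))
                        ≡ - ((q (+ 2) + c) * (q (+ 2) * p * B))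
    collect = solveℚ ℚ-ring

-- The theorem predicts [z^ℓ] wᴺ = 3·rhs(N+1)_ℓ − 4·rhs(N)_ℓ, as (3w − 4)·wᴺ = 3wᴺ⁺¹ − 4wᴺ.
powerFormula : ℕ → ℕ → ℚ
powerFormula N ℓ = q (+ 3) * rhsℤ (+ suc N) ℓ + - (q (+ 4) * rhsℤ (+ N) ℓ)

powerFormula-zero : ∀ N → powerFormula N 0 ≡ pow2ℕ N
powerFormula-zero N = begin
  q (+ 3) * rhsℤ (+ suc N) 0 + - (q (+ 4) * rhsℤ (+ N) 0)
    ≡⟨ cong₂ (λ r₁ r₀ → q (+ 3) * r₁ + - (q (+ 4) * r₀))
             (trans (rhsℤ-zero (+ suc N)) (cong pow2ℤ (ℤP.pred-suc (+ N)))) (rhsℤ-zero (+ N)) ⟩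
  q (+ 3) * pow2ℤ (+ N) + - (q (+ 4) * pow2ℤ (ℤ.pred (+ N)))
    ≡⟨ cong (λ p → q (+ 3) * p + - (q (+ 4) * pow2ℤ (ℤ.pred (+ N)))) 2^N≡2*2^[N-1] ⟩
  q (+ 3) * (q (+ 2) * pow2ℤ (ℤ.pred (+ N))) + - (q (+ 4) * pow2ℤ (ℤ.pred (+ N)))
    ≡⟨ collect (pow2ℤ (ℤ.pred (+ N))) ⟩
  q (+ 2) * pow2ℤ (ℤ.pred (+ N))
    ≡⟨ 2^N≡2*2^[N-1] ⟨
  pow2ℕ N ∎
  where
  open ≡-Reasoning
  2^N≡2*2^[N-1] : pow2ℕ N ≡ q (+ 2) * pow2ℤ (ℤ.pred (+ N))
  2^N≡2*2^[N-1] = trans (cong pow2ℤ (sym (ℤP.suc-pred (+ N)))) (pow2ℤ-suc (ℤ.pred (+ N)))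
  collect : ∀ p → q (+ 3) * (q (+ 2) * p) + - (q (+ 4) * p) ≡ q (+ 2) * p
  collect = solveℚ ℚ-ring

powerFormula-euler : ∀ N L → q (+ suc L) * powerFormula (2 ℕ.+ N) (suc L) ≡ - (q (+ (2 ℕ.+ N)) * rhsℤ (+ N) L)
powerFormula-euler N L = rhsℤ-euler (+ N) L

powerFormula-recurrences : Recurrences powerFormula
powerFormula-recurrences = record { shift = shift ; euler = euler }
  where
  shift : ∀ N L → powerFormula (3 ℕ.+ N) (suc L) + - (q (+ 2) * powerFormula (2 ℕ.+ N) (suc L)) + powerFormula N L ≡ 0ℚ
  shift N L = trans
    (regroup (rhsℤ (+ (4 ℕ.+ N)) (suc L)) (rhsℤ (+ (3 ℕ.+ N)) (suc L)) (rhsℤ (+ (2 ℕ.+ N)) (suc L)) (rhsℤ (+ suc N) L) (rhsℤ (+ N) L))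
    (cong₂ (λ e₁ e₀ → q (+ 3) * e₁ + - (q (+ 4) * e₀)) (rhsℤ-pascal (+ suc N) L) (rhsℤ-pascal (+ N) L))
    where
    regroup : ∀ r₄ r₃ r₂ r₁ r₀ → (q (+ 3) * r₄ + - (q (+ 4) * r₃)) + - (q (+ 2) * (q (+ 3) * r₃ + - (q (+ 4) * r₂))) + (q (+ 3) * r₁ + - (q (+ 4) * r₀))
      ≡ q (+ 3) * (r₄ + - (q (+ 2) * r₃) + r₁) + - (q (+ 4) * (r₃ + - (q (+ 2) * r₂) + r₀))
    regroup = solveℚ ℚ-ring
  euler : ∀ N L → (q (+ 3) * q (+ (2 ℕ.+ N))) * (q (+ suc L) * powerFormula (3 ℕ.+ N) (suc L))
                + - ((q (+ 4) * q (+ (3 ℕ.+ N))) * (q (+ suc L) * powerFormula (2 ℕ.+ N) (suc L)))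
                + (q (+ (2 ℕ.+ N)) * q (+ (3 ℕ.+ N))) * powerFormula N L ≡ 0ℚ
  euler N L = trans
    (cong₂ (λ e₃ e₂ → (q (+ 3) * n₂) * e₃ + - ((q (+ 4) * n₃) * e₂) + (n₂ * n₃) * powerFormula N L)
           (powerFormula-euler (suc N) L) (powerFormula-euler N L))
    (cancel n₂ n₃ (rhsℤ (+ suc N) L) (rhsℤ (+ N) L))
    where
    n₂ = q (+ (2 ℕ.+ N))
    n₃ = q (+ (3 ℕ.+ N))
    cancel : ∀ n₂ n₃ r₁ r₀ → (q (+ 3) * n₂) * - (n₃ * r₁) + - ((q (+ 4) * n₃) * - (n₂ * r₀)) + (n₂ * n₃) * (q (+ 3) * r₁ + - (q (+ 4) * r₀)) ≡ 0ℚ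
    cancel = solveℚ ℚ-ring

powerFormula-0 : ∀ L → powerFormula 0 L ≡ const 1ℚ L
powerFormula-0 zero    = powerFormula-zero 0
-- rhsℤ-euler at c = −2, where the factor c + 2 vanishes.
powerFormula-0 (suc L) = q[n]*x≡0⇒x≡0 (suc L) (trans (rhsℤ-euler -[1+ 1 ] L) (cong -_ (ℚP.*-zeroˡ (rhsℤ -[1+ 1 ] L))))

-- Powers of a root of w³ − 2w² + z = 0

module RootOfCubic (w : PS) (cubic : w ^S 3 ⊝ const (q (+ 2)) ⊛ w ^S 2 ⊕ zS ≋ 𝟘) where

  θ-cubic : (const (q (+ 3)) ⊛ w ^S 2 ⊝ const (q (+ 4)) ⊛ w) ⊛ θ w ⊕ zS ≋ 𝟘
  θ-cubic = begin
    (c₃ ⊛ w ^S 2 ⊝ c₄ ⊛ w) ⊛ θ w ⊕ zS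
      ≈⟨ solve 3 (λ w w′ z → (con (q (+ 3)) :* w :^ 2 :- con (q (+ 4)) :* w) :* w′ :+ z
                       := con (q (+ 3)) :* (w :^ 2 :* w′) :- con (q (+ 2)) :* (con (q (+ 2)) :* (w :^ 1 :* w′)) :+ z)
               ≋-refl w (θ w) zS ⟩
    c₃ ⊛ (w ^S 2 ⊛ θ w) ⊝ c₂ ⊛ (c₂ ⊛ (w ^S 1 ⊛ θ w)) ⊕ zS
      ≈⟨ ⊕-cong (⊕-cong (≋-sym (θ-^S-suc w 2)) (⊖-cong (⊛-cong {f = c₂} ≋-refl (≋-sym (θ-^S-suc w 1))))) (≋-sym θ-zS) ⟩
    θ (w ^S 3) ⊝ c₂ ⊛ θ (w ^S 2) ⊕ θ zS
      ≈⟨ ⊕-cong {g = θ zS} (⊕-cong {f = θ (w ^S 3)} ≋-refl (⊖-cong (≋-sym (θ-const-⊛ (q (+ 2)) (w ^S 2))))) ≋-refl ⟩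
    θ (w ^S 3) ⊝ θ (c₂ ⊛ w ^S 2) ⊕ θ zS
      ≈⟨ ⊕-cong {g = θ zS} (⊕-cong {f = θ (w ^S 3)} ≋-refl (≋-sym (θ-⊖ (c₂ ⊛ w ^S 2)))) ≋-refl ⟩
    θ (w ^S 3) ⊕ θ (⊖ (c₂ ⊛ w ^S 2)) ⊕ θ zS
      ≈⟨ ≋-sym (≋-trans (θ-⊕ (w ^S 3 ⊝ c₂ ⊛ w ^S 2) zS) (⊕-cong {g = θ zS} (θ-⊕ (w ^S 3) (⊖ (c₂ ⊛ w ^S 2))) ≋-refl)) ⟩
    θ (w ^S 3 ⊝ c₂ ⊛ w ^S 2 ⊕ zS)
      ≈⟨ θ-cong cubic ⟩
    θ 𝟘
      ≈⟨ θ-const 0ℚ ⟩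
    𝟘 ∎
    where
    open ≋-Reasoning
    c₂ = const (q (+ 2))
    c₃ = const (q (+ 3))
    c₄ = const (q (+ 4))

  powers : ℕ → ℕ → ℚ
  powers N = w ^S N

  shift-series : ∀ N → w ^S (3 ℕ.+ N) ⊝ const (q (+ 2)) ⊛ w ^S (2 ℕ.+ N) ⊕ zS ⊛ w ^S N ≋ 𝟘
  shift-series N = begin
    w ^S (3 ℕ.+ N) ⊝ const (q (+ 2)) ⊛ w ^S (2 ℕ.+ N) ⊕ zS ⊛ w ^S N
      ≈⟨ solve 3 (λ w wᴺ z → w :* (w :* (w :* wᴺ)) :- con (q (+ 2)) :* (w :* (w :* wᴺ)) :+ z :* wᴺ
                       := (w :^ 3 :- con (q (+ 2)) :* w :^ 2 :+ z) :* wᴺ) ≋-refl w (w ^S N) zS ⟩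
    (w ^S 3 ⊝ const (q (+ 2)) ⊛ w ^S 2 ⊕ zS) ⊛ w ^S N
      ≈⟨ ⊛-cong {g = w ^S N} cubic ≋-refl ⟩
    𝟘 ⊛ w ^S N
      ≈⟨ solve 1 (λ f → con 0ℚ :* f := con 0ℚ) ≋-refl (w ^S N) ⟩
    𝟘 ∎
    where open ≋-Reasoning

  euler-series : ∀ N → (const (q (+ 3)) ⊛ const (q (+ (2 ℕ.+ N)))) ⊛ θ (w ^S (3 ℕ.+ N))
                     ⊝ (const (q (+ 4)) ⊛ const (q (+ (3 ℕ.+ N)))) ⊛ θ (w ^S (2 ℕ.+ N))
                     ⊕ (const (q (+ (2 ℕ.+ N))) ⊛ const (q (+ (3 ℕ.+ N)))) ⊛ (zS ⊛ w ^S N) ≋ 𝟘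
  euler-series N = begin
    (c₃ ⊛ n₂) ⊛ θ (w ^S (3 ℕ.+ N)) ⊝ (c₄ ⊛ n₃) ⊛ θ (w ^S (2 ℕ.+ N)) ⊕ (n₂ ⊛ n₃) ⊛ (zS ⊛ w ^S N)
      ≈⟨ ⊕-cong {g = (n₂ ⊛ n₃) ⊛ (zS ⊛ w ^S N)} (⊕-cong (⊛-cong {f = c₃ ⊛ n₂} ≋-refl (θ-^S-suc w (2 ℕ.+ N)))
                                                        (⊖-cong (⊛-cong {f = c₄ ⊛ n₃} ≋-refl (θ-^S-suc w (suc N))))) ≋-refl ⟩
    (c₃ ⊛ n₂) ⊛ (n₃ ⊛ (w ^S (2 ℕ.+ N) ⊛ θ w)) ⊝ (c₄ ⊛ n₃) ⊛ (n₂ ⊛ (w ^S (suc N) ⊛ θ w)) ⊕ (n₂ ⊛ n₃) ⊛ (zS ⊛ w ^S N)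
      ≈⟨ solve 6 (λ n₂ n₃ w wᴺ w′ z →
                    (con (q (+ 3)) :* n₂) :* (n₃ :* ((w :* (w :* wᴺ)) :* w′)) :- (con (q (+ 4)) :* n₃) :* (n₂ :* ((w :* wᴺ) :* w′))
                      :+ (n₂ :* n₃) :* (z :* wᴺ)
                    := ((n₂ :* n₃) :* wᴺ) :* ((con (q (+ 3)) :* w :^ 2 :- con (q (+ 4)) :* w) :* w′ :+ z))
               ≋-refl n₂ n₃ w (w ^S N) (θ w) zS ⟩
    ((n₂ ⊛ n₃) ⊛ w ^S N) ⊛ ((c₃ ⊛ w ^S 2 ⊝ c₄ ⊛ w) ⊛ θ w ⊕ zS)
      ≈⟨ ⊛-cong {f = (n₂ ⊛ n₃) ⊛ w ^S N} ≋-refl θ-cubic ⟩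
    ((n₂ ⊛ n₃) ⊛ w ^S N) ⊛ 𝟘
      ≈⟨ solve 1 (λ f → f :* con 0ℚ := con 0ℚ) ≋-refl ((n₂ ⊛ n₃) ⊛ w ^S N) ⟩
    𝟘 ∎
    where
    open ≋-Reasoning
    c₃ = const (q (+ 3))
    c₄ = const (q (+ 4))
    n₂ = const (q (+ (2 ℕ.+ N)))
    n₃ = const (q (+ (3 ℕ.+ N)))

  powers-recurrences : Recurrences powers
  powers-recurrences = record { shift = shift ; euler = euler }
    where
    shift : ∀ N L → powers (3 ℕ.+ N) (suc L) + - (q (+ 2) * powers (2 ℕ.+ N) (suc L)) + powers N L ≡ 0ℚ
    shift N L = trans (cong₂ (λ x₂ x₀ → powers (3 ℕ.+ N) (suc L) + - x₂ + x₀)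
                             (sym (const-⊛ (q (+ 2)) (w ^S (2 ℕ.+ N)) (suc L))) (sym (zS-⊛-suc (w ^S N) L)))
                      (shift-series N (suc L))
    euler : ∀ N L → (q (+ 3) * q (+ (2 ℕ.+ N))) * (q (+ suc L) * powers (3 ℕ.+ N) (suc L))
                  + - ((q (+ 4) * q (+ (3 ℕ.+ N))) * (q (+ suc L) * powers (2 ℕ.+ N) (suc L)))
                  + (q (+ (2 ℕ.+ N)) * q (+ (3 ℕ.+ N))) * powers N L ≡ 0ℚ
    euler N L = trans
      (cong₂ _+_ (cong₂ (λ x₃ x₂ → x₃ + - x₂)
                        (sym (const-⊛-const-⊛ (q (+ 3)) (q (+ (2 ℕ.+ N))) (θ (w ^S (3 ℕ.+ N))) (suc L)))
                        (sym (const-⊛-const-⊛ (q (+ 4)) (q (+ (3 ℕ.+ N))) (θ (w ^S (2 ℕ.+ N))) (suc L))))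
                 (trans (cong ((q (+ (2 ℕ.+ N)) * q (+ (3 ℕ.+ N))) *_) (sym (zS-⊛-suc (w ^S N) L)))
                        (sym (const-⊛-const-⊛ (q (+ (2 ℕ.+ N))) (q (+ (3 ℕ.+ N))) (zS ⊛ w ^S N) (suc L)))))
      (euler-series N (suc L))

  θ-powers : ∀ n → (const (q (+ 3)) ⊛ w ⊝ const (q (+ 4))) ⊛ θ (w ^S (2 ℕ.+ n)) ≋ ⊖ (const (q (+ (2 ℕ.+ n))) ⊛ (zS ⊛ w ^S n))
  θ-powers n = begin
    (c₃ ⊛ w ⊝ c₄) ⊛ θ (w ^S (2 ℕ.+ n))
      ≈⟨ ⊛-cong {f = c₃ ⊛ w ⊝ c₄} ≋-refl (θ-^S-suc w (suc n)) ⟩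
    (c₃ ⊛ w ⊝ c₄) ⊛ (n₂ ⊛ (w ^S suc n ⊛ θ w))
      ≈⟨ solve 5 (λ n₂ w wⁿ w′ z → (con (q (+ 3)) :* w :- con (q (+ 4))) :* (n₂ :* ((w :* wⁿ) :* w′))
                            := (n₂ :* wⁿ) :* ((con (q (+ 3)) :* w :^ 2 :- con (q (+ 4)) :* w) :* w′ :+ z) :- n₂ :* (z :* wⁿ))
               ≋-refl n₂ w (w ^S n) (θ w) zS ⟩
    (n₂ ⊛ w ^S n) ⊛ ((c₃ ⊛ w ^S 2 ⊝ c₄ ⊛ w) ⊛ θ w ⊕ zS) ⊝ n₂ ⊛ (zS ⊛ w ^S n)
      ≈⟨ ⊕-cong {g = ⊖ (n₂ ⊛ (zS ⊛ w ^S n))} (⊛-cong {f = n₂ ⊛ w ^S n} ≋-refl θ-cubic) ≋-refl ⟩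
    (n₂ ⊛ w ^S n) ⊛ 𝟘 ⊝ n₂ ⊛ (zS ⊛ w ^S n)
      ≈⟨ solve 2 (λ f g → f :* con 0ℚ :- g := :- g) ≋-refl (n₂ ⊛ w ^S n) (n₂ ⊛ (zS ⊛ w ^S n)) ⟩
    ⊖ (n₂ ⊛ (zS ⊛ w ^S n)) ∎
    where
    open ≋-Reasoning
    c₃ = const (q (+ 3))
    c₄ = const (q (+ 4))
    n₂ = const (q (+ (2 ℕ.+ n)))

  module _ (w₀≡2 : w 0 ≡ q (+ 2)) where

    powers-zero : ∀ N → powers N 0 ≡ pow2ℕ N
    powers-zero zero    = refl
    powers-zero (suc N) = trans (⊛-zero w (w ^S N)) (cong₂ _*_ w₀≡2 (powers-zero N))

    powers≡powerFormula : ∀ N L → powers (2 ℕ.+ N) L ≡ powerFormula (2 ℕ.+ N) L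
    powers≡powerFormula N L = difference-zero (Recurrences-vanish
      (Recurrences-− powers-recurrences powerFormula-recurrences)
      (λ L → trans (cong (_+_ (const 1ℚ L)) (cong -_ (powerFormula-0 L))) (ℚP.+-inverseʳ (const 1ℚ L)))
      (λ N → trans (cong₂ (λ x y → x + - y) (powers-zero (2 ℕ.+ N)) (powerFormula-zero (2 ℕ.+ N))) (ℚP.+-inverseʳ (pow2ℕ (2 ℕ.+ N))))
      L N)
      where
      difference-zero : ∀ {x y} → x + - y ≡ 0ℚ → x ≡ y
      difference-zero {x} {y} x-y≡0 = trans (add-back x y) (trans (cong (_+ y) x-y≡0) (ℚP.+-identityˡ y))
        where
        add-back : ∀ x y → x ≡ (x + - y) + y
        add-back = solveℚ ℚ-ring

    θ-powers≡rhs : ∀ n → θ (w ^S (2 ℕ.+ n)) ≋ ⊖ (const (q (+ (2 ℕ.+ n))) ⊛ (zS ⊛ rhs n))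
    θ-powers≡rhs n zero    = begin
      0ℚ * powers (2 ℕ.+ n) 0                                   ≡⟨ ℚP.*-zeroˡ (powers (2 ℕ.+ n) 0) ⟩
      0ℚ                                                        ≡⟨ cong -_ (ℚP.*-zeroʳ (q (+ (2 ℕ.+ n)))) ⟨
      - (q (+ (2 ℕ.+ n)) * 0ℚ)                                  ≡⟨ cong (λ x → - (q (+ (2 ℕ.+ n)) * x)) (trans (⊛-zero zS (rhs n)) (ℚP.*-zeroˡ (rhs n 0))) ⟨
      - (q (+ (2 ℕ.+ n)) * (zS ⊛ rhs n) 0)                      ≡⟨ cong -_ (const-⊛ (q (+ (2 ℕ.+ n))) (zS ⊛ rhs n) 0) ⟨
      - ((const (q (+ (2 ℕ.+ n))) ⊛ (zS ⊛ rhs n)) 0)            ∎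
      where open ≡-Reasoning
    θ-powers≡rhs n (suc L) = begin
      q (+ suc L) * powers (2 ℕ.+ n) (suc L)                    ≡⟨ cong (q (+ suc L) *_) (powers≡powerFormula n (suc L)) ⟩
      q (+ suc L) * powerFormula (2 ℕ.+ n) (suc L)              ≡⟨ powerFormula-euler n L ⟩
      - (q (+ (2 ℕ.+ n)) * rhs n L)                             ≡⟨ cong (λ x → - (q (+ (2 ℕ.+ n)) * x)) (zS-⊛-suc (rhs n) L) ⟨
      - (q (+ (2 ℕ.+ n)) * (zS ⊛ rhs n) (suc L))                ≡⟨ cong -_ (const-⊛ (q (+ (2 ℕ.+ n))) (zS ⊛ rhs n) (suc L)) ⟨
      - ((const (q (+ (2 ℕ.+ n))) ⊛ (zS ⊛ rhs n)) (suc L))      ∎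
      where open ≡-Reasoning

    [3w-4]⊛rhs≋w^n : ∀ n → (const (q (+ 3)) ⊛ w ⊝ const (q (+ 4))) ⊛ rhs n ≋ w ^S n
    [3w-4]⊛rhs≋w^n n k = q[n]*-cancelˡ (2 ℕ.+ n) (begin
      q (+ (2 ℕ.+ n)) * (A ⊛ rhs n) k              ≡⟨ scaled-zS-⊛ (q (+ (2 ℕ.+ n))) (A ⊛ rhs n) k ⟨
      (n₂ ⊛ (zS ⊛ (A ⊛ rhs n))) (suc k)            ≡⟨ scaled≋ (suc k) ⟩
      (n₂ ⊛ (zS ⊛ w ^S n)) (suc k)                 ≡⟨ scaled-zS-⊛ (q (+ (2 ℕ.+ n))) (w ^S n) k ⟩
      q (+ (2 ℕ.+ n)) * (w ^S n) k                 ∎)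
      where
      A = const (q (+ 3)) ⊛ w ⊝ const (q (+ 4))
      n₂ = const (q (+ (2 ℕ.+ n)))
      scaled-zS-⊛ : ∀ c f k → (const c ⊛ (zS ⊛ f)) (suc k) ≡ c * f k
      scaled-zS-⊛ c f k = trans (const-⊛ c (zS ⊛ f) (suc k)) (cong (c *_) (zS-⊛-suc f k))
      scaled≋ : n₂ ⊛ (zS ⊛ (A ⊛ rhs n)) ≋ n₂ ⊛ (zS ⊛ w ^S n)
      scaled≋ = begin
        n₂ ⊛ (zS ⊛ (A ⊛ rhs n))            ≈⟨ solve 4 (λ n₂ z a r → n₂ :* (z :* (a :* r)) := :- (a :* (:- (n₂ :* (z :* r))))) ≋-refl n₂ zS A (rhs n) ⟩
        ⊖ (A ⊛ ⊖ (n₂ ⊛ (zS ⊛ rhs n)))      ≈⟨ ⊖-cong (⊛-cong {f = A} ≋-refl (≋-sym (θ-powers≡rhs n))) ⟩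
        ⊖ (A ⊛ θ (w ^S (2 ℕ.+ n)))         ≈⟨ ⊖-cong (θ-powers n) ⟩
        ⊖ (⊖ (n₂ ⊛ (zS ⊛ w ^S n)))         ≈⟨ solve 1 (λ f → :- (:- f) := f) ≋-refl (n₂ ⊛ (zS ⊛ w ^S n)) ⟩
        n₂ ⊛ (zS ⊛ w ^S n)                 ∎
        where open ≋-Reasoning
      open ≡-Reasoning

2-u-root : ∀ u → u ⊛ ((u ⊝ const (q (+ 2))) ^S 2) ≋ zS →
           (const (q (+ 2)) ⊝ u) ^S 3 ⊝ const (q (+ 2)) ⊛ (const (q (+ 2)) ⊝ u) ^S 2 ⊕ zS ≋ 𝟘
2-u-root u u[u-2]²≋z = begin
  w ^S 3 ⊝ const (q (+ 2)) ⊛ w ^S 2 ⊕ zS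
    ≈⟨ ⊕-cong {f = w ^S 3 ⊝ const (q (+ 2)) ⊛ w ^S 2} ≋-refl (≋-sym u[u-2]²≋z) ⟩
  w ^S 3 ⊝ const (q (+ 2)) ⊛ w ^S 2 ⊕ u ⊛ (u ⊝ const (q (+ 2))) ^S 2
    ≈⟨ solve 1 (λ u → (con (q (+ 2)) :- u) :^ 3 :- con (q (+ 2)) :* (con (q (+ 2)) :- u) :^ 2 :+ u :* (u :- con (q (+ 2))) :^ 2
                    := con 0ℚ) ≋-refl u ⟩
  𝟘 ∎
  where
  open ≋-Reasoning
  w = const (q (+ 2)) ⊝ u

⊛[1+3[u-1]]≋-[3[2-u]-4]⊛ : ∀ r u → r ⊛ (const (q (+ 1)) ⊕ q (+ 3) · (u ⊝ const (q (+ 1))))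
                                   ≋ ⊖ ((const (q (+ 3)) ⊛ (const (q (+ 2)) ⊝ u) ⊝ const (q (+ 4))) ⊛ r)
⊛[1+3[u-1]]≋-[3[2-u]-4]⊛ r u = begin
  r ⊛ (const (q (+ 1)) ⊕ q (+ 3) · (u ⊝ const (q (+ 1))))
    ≈⟨ ⊛-cong {f = r} ≋-refl (⊕-cong {f = const (q (+ 1))} ≋-refl (≋-sym (const-⊛ (q (+ 3)) (u ⊝ const (q (+ 1)))))) ⟩
  r ⊛ (const (q (+ 1)) ⊕ const (q (+ 3)) ⊛ (u ⊝ const (q (+ 1))))
    ≈⟨ solve 2 (λ r u → r :* (con (q (+ 1)) :+ con (q (+ 3)) :* (u :- con (q (+ 1))))
                      := :- ((con (q (+ 3)) :* (con (q (+ 2)) :- u) :- con (q (+ 4))) :* r)) ≋-refl r u ⟩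
  ⊖ ((const (q (+ 3)) ⊛ (const (q (+ 2)) ⊝ u) ⊝ const (q (+ 4))) ⊛ r) ∎
  where open ≋-Reasoning

⊛[3u-2]≋-[3[2-u]-4]⊛ : ∀ r u → r ⊛ (q (+ 3) · u ⊝ const (q (+ 2)))
                               ≋ ⊖ ((const (q (+ 3)) ⊛ (const (q (+ 2)) ⊝ u) ⊝ const (q (+ 4))) ⊛ r)
⊛[3u-2]≋-[3[2-u]-4]⊛ r u = begin
  r ⊛ (q (+ 3) · u ⊝ const (q (+ 2)))
    ≈⟨ ⊛-cong {f = r} ≋-refl (⊕-cong {g = ⊖ const (q (+ 2))} (≋-sym (const-⊛ (q (+ 3)) u)) ≋-refl) ⟩
  r ⊛ (const (q (+ 3)) ⊛ u ⊝ const (q (+ 2)))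
    ≈⟨ solve 2 (λ r u → r :* (con (q (+ 3)) :* u :- con (q (+ 2)))
                      := :- ((con (q (+ 3)) :* (con (q (+ 2)) :- u) :- con (q (+ 4))) :* r)) ≋-refl r u ⟩
  ⊖ ((const (q (+ 3)) ⊛ (const (q (+ 2)) ⊝ u) ⊝ const (q (+ 4))) ⊛ r) ∎
  where open ≋-Reasoning

2-u≋1-[u-1] : ∀ u → const (q (+ 2)) ⊝ u ≋ const (q (+ 1)) ⊝ (u ⊝ const (q (+ 1)))
2-u≋1-[u-1] u = solve 1 (λ u → con (q (+ 2)) :- u := con (q (+ 1)) :- (u :- con (q (+ 1)))) ≋-refl u

mainTheorem4 : (u : PS) → u 0 ≡ q (+ 0) → u ⊛ ((u ⊝ const (q (+ 2))) ^S 2) ≋ zS →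
    (n : ℕ) →
      (rhs n ⊛ (const (q (+ 1)) ⊕ q (+ 3) · (u ⊝ const (q (+ 1))))
        ≋ ⊖ ((const (q (+ 1)) ⊝ (u ⊝ const (q (+ 1)))) ^S n))
      × (rhs n ⊛ (q (+ 3) · u ⊝ const (q (+ 2)))
        ≋ ⊖ ((const (q (+ 2)) ⊝ u) ^S n))
mainTheorem4 u u₀≡0 u[u-2]²≋z n =
    ≋-trans (⊛[1+3[u-1]]≋-[3[2-u]-4]⊛ (rhs n) u) (⊖-cong (≋-trans [3w-4]⊛rhs≋wⁿ (^S-cong n (2-u≋1-[u-1] u))))
  , ≋-trans (⊛[3u-2]≋-[3[2-u]-4]⊛ (rhs n) u) (⊖-cong [3w-4]⊛rhs≋wⁿ)
  where
  open RootOfCubic (const (q (+ 2)) ⊝ u) (2-u-root u u[u-2]²≋z)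
  [3w-4]⊛rhs≋wⁿ : (const (q (+ 3)) ⊛ (const (q (+ 2)) ⊝ u) ⊝ const (q (+ 4))) ⊛ rhs n ≋ (const (q (+ 2)) ⊝ u) ^S n
  [3w-4]⊛rhs≋wⁿ = [3w-4]⊛rhs≋w^n (cong (λ x → q (+ 2) + - x) u₀≡0) n
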